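{- Let $G$ be a multigraph and let $E$ and $\{e\}$ be multisets of unordered pairs of elements of $V(G)$. If $\mathrm{cp}(G+E+\{e\}) = \mathrm{cp}(G+E)$, then $M(G,E\uplus\{e\}) = M(G,E)$.
   Context: $\mathrm{cp}(G)$ denotes the number of components of $G$. For multisets $A,B$, $A\uplus B$ is the multiset sum (multiplicities add). For a multiset $F$ of unordered pairs from $V(G)$, $G+F$ is the multigraph on $V(G)$ with edge multiset $E(G)\uplus F$. $M(G,E)$ is the set of vertex sets $C$ of components of $G$ that are merged by $E$, i.e. such that there exist $u\in C$, $v\in V(G)\setminus C$ with $uv\in E$. -}

module Defs where

open import Data.Nat using (ℕ)
open import Data.Fin using (Fin)
open import Data.Fin.Subset using (Subset; _∈_; _∉_)
open import Data.List using (List; _++_; [_])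
open import Data.List.Membership.Propositional using () renaming (_∈_ to _∈ₗ_)
open import Data.Product using (Σ; ∃; ∃-syntax; _×_; _,_)
open import Data.Sum using (_⊎_)
open import Relation.Binary.PropositionalEquality using (_≡_)

-- A multigraph on vertex set V(G) = Fin n is given by its multiset of edges,
-- represented as a list of (unordered) pairs; the pair (u , v) stands for the
-- unordered pair uv (orientation irrelevant), loops (u , u) allowed.
EdgeMultiset : ℕ → Set
EdgeMultiset n = List (Fin n × Fin n)

EdgeIn : ∀ {n} → Fin n → Fin n → EdgeMultiset n → Set
EdgeIn u v F = ((u , v) ∈ₗ F) ⊎ ((v , u) ∈ₗ F)

-- Multiset sum A ⊎ B, and G + F (the multigraph with edge multiset E(G) ⊎ F).
_⊎ₘ_ : ∀ {n} → EdgeMultiset n → EdgeMultiset n → EdgeMultiset n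
A ⊎ₘ B = A ++ B

data Reach {n} (F : EdgeMultiset n) : Fin n → Fin n → Set where
  here : ∀ {u} → Reach F u u
  step : ∀ {u v w} → EdgeIn u v F → Reach F v w → Reach F u w

-- cp(G) = k: the components of G are in bijection with Fin k, i.e. there is a
-- surjective labelling of vertices by Fin k whose fibres are exactly the
-- connectivity classes.
HasCp : ∀ {n} → EdgeMultiset n → ℕ → Set
HasCp {n} F k =
  Σ (Fin n → Fin k) λ f →
    (∀ (i : Fin k) → ∃[ u ] f u ≡ i) ×
    (∀ u v → (f u ≡ f v → Reach F u v) × (Reach F u v → f u ≡ f v))

IsComponent : ∀ {n} → EdgeMultiset n → Subset n → Set
IsComponent {n} F C =
  (∃[ u ] u ∈ C) ×
  (∀ u v → u ∈ C → (v ∈ C → Reach F u v) × (Reach F u v → v ∈ C))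

-- C ∈ M(G,E): C is a component vertex set of G merged by E.
InM : ∀ {n} → EdgeMultiset n → EdgeMultiset n → Subset n → Set
InM G E C =
  IsComponent G C × (∃[ u ] ∃[ v ] (u ∈ C × v ∉ C × EdgeIn u v E))

module Submission where

-- Adding the edge e = ab to G + E keeps the number of
-- components, so e merges nothing: a and b are already connected in G + E.
-- Hence any crossing of the boundary of a component C of G by e can be
-- replaced by a walk in G + E from one end of e to the other; since C is
-- closed under G-edges, that walk must leave C through an edge of E.  So C
-- is merged by E ⊎ {e} exactly when it is merged by E.

open import Defs
open import Data.Fin using (Fin)
open import Data.Fin.Subset using (Subset)
open import Data.List using ([_])
open import Data.Product using (∃-syntax; _×_)

open import Data.Nat using (ℕ; suc)
open import Data.Nat.Properties using (1+n≰n)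
open import Data.Fin using (zero; suc; _≟_)
open import Data.Fin.Properties using (any?; injective⇒≤)
open import Data.Fin.Subset using (_∈_; _∉_)
open import Data.Fin.Subset.Properties using (_∈?_)
open import Data.List using (_++_)
open import Data.List.Relation.Unary.Any using (here)
open import Data.List.Membership.Propositional using () renaming (_∈_ to _∈ₗ_)
open import Data.List.Membership.Propositional.Properties using (∈-++⁺ˡ; ∈-++⁺ʳ; ∈-++⁻)
open import Data.Product using (_,_; proj₁; proj₂)
open import Data.Sum using (_⊎_; inj₁; inj₂; map)
open import Data.Empty using (⊥-elim)
open import Function.Definitions using (Injective)
open import Relation.Nullary using (yes; no; contradiction)
open import Relation.Binary.PropositionalEquality using (_≡_; refl; sym; trans; cong; module ≡-Reasoning)

private
  variable
    n k : ℕ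

EdgeIn-sym : ∀ {u v : Fin n} {F} → EdgeIn u v F → EdgeIn v u F
EdgeIn-sym (inj₁ p) = inj₂ p
EdgeIn-sym (inj₂ p) = inj₁ p

EdgeIn-mono : ∀ {F F′ : EdgeMultiset n} → (∀ {x} → x ∈ₗ F → x ∈ₗ F′) →
              ∀ {u v} → EdgeIn u v F → EdgeIn u v F′
EdgeIn-mono sub = map sub sub

EdgeIn-++⁻ : ∀ (A : EdgeMultiset n) {B u v} →
             EdgeIn u v (A ⊎ₘ B) → EdgeIn u v A ⊎ EdgeIn u v B
EdgeIn-++⁻ A (inj₁ p) = map inj₁ inj₁ (∈-++⁻ A p)
EdgeIn-++⁻ A (inj₂ p) = map inj₂ inj₂ (∈-++⁻ A p)

Reach-trans : ∀ {F : EdgeMultiset n} {u v w} → Reach F u v → Reach F v w → Reach F u w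
Reach-trans here       r′ = r′
Reach-trans (step e r) r′ = step e (Reach-trans r r′)

Reach-sym : ∀ {F : EdgeMultiset n} {u v} → Reach F u v → Reach F v u
Reach-sym here       = here
Reach-sym (step e r) = Reach-trans (Reach-sym r) (step (EdgeIn-sym e) here)

Reach-mono : ∀ {F F′ : EdgeMultiset n} → (∀ {x} → x ∈ₗ F → x ∈ₗ F′) →
             ∀ {u v} → Reach F u v → Reach F′ u v
Reach-mono sub here       = here
Reach-mono sub (step e r) = step (EdgeIn-mono sub e) (Reach-mono sub r)

-- Pigeonhole: an injective endomap of Fin k hits every point, since a
-- missed point z would extend it to an injection Fin (suc k) → Fin k.
injective⇒surjective : ∀ {s : Fin k → Fin k} → Injective _≡_ _≡_ s →
                       ∀ z → ∃[ j ] s j ≡ z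
injective⇒surjective {k = k} {s} s-inj z with any? (λ j → s j ≟ z)
... | yes hit  = hit
... | no  miss = contradiction (injective⇒≤ t-inj) 1+n≰n
  where
  t : Fin (suc k) → Fin k
  t zero    = z
  t (suc j) = s j

  t-inj : Injective _≡_ _≡_ t
  t-inj {zero}  {zero}  _  = refl
  t-inj {zero}  {suc j} eq = contradiction (j , sym eq) miss
  t-inj {suc i} {zero}  eq = contradiction (i , eq) miss
  t-inj {suc i} {suc j} eq = cong suc (s-inj eq)

-- An endomap h of Fin k with a right inverse s is injective: s is injective,
-- hence onto, so both arguments of h are values of s.
retraction⇒injective : ∀ (h s : Fin k → Fin k) → (∀ j → h (s j) ≡ j) →
                       Injective _≡_ _≡_ h
retraction⇒injective h s hs {x} {y} hx≡hy
  with injective⇒surjective s-inj x | injective⇒surjective s-inj y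
  where
  s-inj : Injective _≡_ _≡_ s
  s-inj {i} {j} eq = trans (sym (hs i)) (trans (cong h eq) (hs j))
... | i , refl | j , refl = cong s (trans (sym (hs i)) (trans hx≡hy (hs j)))

-- The F′-label of an F-component, h, is a map
-- Fin k → Fin k with a right inverse (pick a vertex of each F′-component and
-- take its F-label), so h is injective and no two F-components are merged.
equal-cp⇒same-reach : ∀ {F F′ : EdgeMultiset n} → (∀ {x} → x ∈ₗ F → x ∈ₗ F′) →
                      HasCp F′ k → HasCp F k →
                      ∀ {u v} → Reach F′ u v → Reach F u v
equal-cp⇒same-reach {n = n} {k = k} sub (f , f-onto , f-comp) (g , g-onto , g-comp) {u} {v} r′ =
  proj₁ (g-comp u v) (retraction⇒injective h s h∘s hgu≡hgv)
  where
  h : Fin k → Fin k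
  h i = f (proj₁ (g-onto i))

  s : Fin k → Fin k
  s j = g (proj₁ (f-onto j))

  hg : ∀ (w : Fin n) → h (g w) ≡ f w
  hg w = proj₂ (f-comp _ w) (Reach-mono sub (proj₁ (g-comp _ w) (proj₂ (g-onto (g w)))))

  h∘s : ∀ j → h (s j) ≡ j
  h∘s j = trans (hg _) (proj₂ (f-onto j))

  hgu≡hgv : h (g u) ≡ h (g v)
  hgu≡hgv = begin
    h (g u) ≡⟨ hg u ⟩
    f u     ≡⟨ proj₂ (f-comp u v) r′ ⟩
    f v     ≡⟨ hg v ⟨
    h (g v) ∎
    where open ≡-Reasoning

Leaves : Subset n → EdgeMultiset n → Set
Leaves C F = ∃[ x ] ∃[ y ] (x ∈ C × y ∉ C × EdgeIn x y F)

Leaves-mono : ∀ {C : Subset n} {F F′} → (∀ {x} → x ∈ₗ F → x ∈ₗ F′) →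
              Leaves C F → Leaves C F′
Leaves-mono sub (x , y , xC , yC , xy) = x , y , xC , yC , EdgeIn-mono sub xy

GClosed : EdgeMultiset n → Subset n → Set
GClosed G C = ∀ {u w} → u ∈ C → EdgeIn u w G → w ∈ C

component⇒closed : ∀ {G : EdgeMultiset n} {C} → IsComponent G C → GClosed G C
component⇒closed (_ , comp) {u} {w} uC uw = proj₂ (comp u w uC) (step uw here)

-- A walk of G + E from inside a G-closed set C to outside of it leaves C
-- through an edge of E: its first edge leaving C cannot be a G-edge.
walk-exit : ∀ (G : EdgeMultiset n) {E C} → GClosed G C →
            ∀ {u v} → Reach (G ⊎ₘ E) u v → u ∈ C → v ∉ C → Leaves C E
walk-exit G closed here uC vC = ⊥-elim (vC uC)
walk-exit G {C = C} closed {u} (step {v = w} uw r) uC vC with w ∈? C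
... | yes wC = walk-exit G closed r wC vC
... | no  wC with EdgeIn-++⁻ G uw
...   | inj₁ uwG = contradiction (closed uC uwG) wC
...   | inj₂ uwE = u , w , uC , wC , uwE

drop-connected-edge : ∀ (G E : EdgeMultiset n) {a b C} → GClosed G C →
                      Reach (G ⊎ₘ E) a b → Leaves C (E ⊎ₘ [ (a , b) ]) → Leaves C E
drop-connected-edge G E closed rab (u , v , uC , vC , uv) with EdgeIn-++⁻ E uv
... | inj₁ uvE               = u , v , uC , vC , uvE
... | inj₂ (inj₁ (here refl)) = walk-exit G closed rab uC vC
... | inj₂ (inj₂ (here refl)) = walk-exit G closed (Reach-sym rab) uC vC


lemma4p5 : ∀ {n} (G E : EdgeMultiset n) (e : Fin n × Fin n) →
    (∃[ k ] (HasCp ((G ⊎ₘ E) ⊎ₘ [ e ]) k × HasCp (G ⊎ₘ E) k)) →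
    ∀ (C : Subset n) → (InM G (E ⊎ₘ [ e ]) C → InM G E C) × (InM G E C → InM G (E ⊎ₘ [ e ]) C)
lemma4p5 G E (a , b) (k , cp-with-e , cp) C = shrink , grow
  where
  -- e merges no components of G + E, so its ends are already connected.
  rab : Reach (G ⊎ₘ E) a b
  rab = equal-cp⇒same-reach ∈-++⁺ˡ cp-with-e cp (step (inj₁ (∈-++⁺ʳ (G ⊎ₘ E) (here refl))) here)

  shrink : InM G (E ⊎ₘ [ (a , b) ]) C → InM G E C
  shrink (comp , crossing) = comp , drop-connected-edge G E (component⇒closed comp) rab crossing

  grow : InM G E C → InM G (E ⊎ₘ [ (a , b) ]) C
  grow (comp , crossing) = comp , Leaves-mono ∈-++⁺ˡ crossing
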